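{- Let $L/K$ be a finite Galois extension of fields with Galois group $G$, let $N$ be a $G$-stable regular subgroup of $\mathrm{Perm}(G)$, let $g \in G$, and put $N_g = \rho(g)N\rho(g)^{ -1}$. Let $\phi : L[N]^G \to L[N_g]^G$ be the map $\phi\left(\sum_{\eta \in N} c_\eta \eta\right) = \sum_{\eta \in N} c_\eta\, \rho(g)\eta\rho(g)^{ -1}$ ($c_\eta \in L$). Then for all $x \in L$ and all $z \in L[N]^G$ we have $$\phi(z)\cdot x = g\bigl(z \cdot g^{ -1}(x)\bigr).$$
   Context: $\mathrm{Perm}(G)$ is the group of permutations of the set $G$; $\lambda(g)[h]=gh$ and $\rho(g)[h]=hg^{ -1}$ are the left and right regular representations. A subgroup $N\le \mathrm{Perm}(G)$ is regular if it acts simply transitively on $G$, and $G$-stable if it is normalized by $\lambda(G)$. For such $N$, $G$ acts on the group algebra $L[N]$ by $g\ast\sum_\eta c_\eta\eta = \sum_\eta g(c_\eta)\,\lambda(g)\eta\lambda(g)^{ -1}$, and $L[N]^G$ denotes the fixed ring, a $K$-Hopf algebra; $N_g$ is again $G$-stable and regular, and $\phi$ is an isomorphism of $K$-Hopf algebras $L[N]^G\to L[N_g]^G$. The action of $L[N]^G$ on $L$ (giving a Hopf-Galois structure on $L/K$) is $\left(\sum_{\eta\in N} c_\eta\eta\right)\cdot x = \sum_{\eta\in N} c_\eta\, \eta^{ -1}[e_G](x)$, where $\eta^{ -1}[e_G]\in G$ acts on $x$ via the Galois action; the action of $L[N_g]^G$ on $L$ is given by the analogous formula. -}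

module Defs where

open import Level using (Level; _⊔_; suc)
open import Data.Nat using (ℕ)
open import Data.Fin using (Fin)
open import Data.Product using (Σ; _×_; _,_; ∃)
open import Function using (_↔_; _∘_; Inverse)
open import Function.Bundles using (mk↔ₛ′)
open import Relation.Binary.PropositionalEquality using (_≡_; refl; cong; sym; trans)
open import Relation.Nullary using (¬_)
open import Algebra.Bundles using (CommutativeRing)
open import Algebra.Structures using (IsGroup)
import Algebra.Definitions.RawMonoid as RawMonoidDefs

record Field (c ℓ : Level) : Set (suc (c ⊔ ℓ)) where
  field
    commutativeRing : CommutativeRing c ℓ
  open CommutativeRing commutativeRing public
  field
    0≉1     : ¬ (0# ≈ 1#)
    inverse : ∀ x → ¬ (x ≈ 0#) → Σ Carrier λ y → (x * y) ≈ 1#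

-- Finite groups, with propositional equality (so that Perm(G) makes sense
-- as the permutations of the underlying set).

record FiniteGroup : Set₁ where
  field
    Carrier : Set
    _·_     : Carrier → Carrier → Carrier
    e       : Carrier
    _⁻¹     : Carrier → Carrier
    isGroup : IsGroup _≡_ _·_ e _⁻¹
    order   : ℕ
    enum    : Fin order ↔ Carrier
  infixl 7 _·_
  infix 8 _⁻¹

module PermDefs (G : FiniteGroup) where
  open FiniteGroup G
  open IsGroup isGroup using (assoc; identityˡ; identityʳ; inverseˡ; inverseʳ)

  Perm : Set
  Perm = Carrier ↔ Carrier

  _[_] : Perm → Carrier → Carrier
  η [ h ] = Inverse.to η h

  _⁻¹ₚ : Perm → Perm
  η ⁻¹ₚ = Function.Bundles.mk↔ₛ′ (Inverse.from η) (Inverse.to η)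
            (Inverse.strictlyInverseʳ η) (Inverse.strictlyInverseˡ η)

  _∘ₚ_ : Perm → Perm → Perm
  σ ∘ₚ τ = Function.Bundles.mk↔ₛ′ (Inverse.to σ ∘ Inverse.to τ) (Inverse.from τ ∘ Inverse.from σ)
             (λ x → trans (cong (Inverse.to σ) (Inverse.strictlyInverseˡ τ _)) (Inverse.strictlyInverseˡ σ x))
             (λ x → trans (cong (Inverse.from τ) (Inverse.strictlyInverseʳ σ _)) (Inverse.strictlyInverseʳ τ x))

  idₚ : Perm
  idₚ = mk↔ₛ′ (λ h → h) (λ h → h) (λ _ → refl) (λ _ → refl)

  _≗ₚ_ : Perm → Perm → Set
  σ ≗ₚ τ = ∀ h → σ [ h ] ≡ τ [ h ]

  λ-reg : Carrier → Perm
  λ-reg g = mk↔ₛ′ (λ h → g · h) (λ h → g ⁻¹ · h)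
    (λ h → trans (sym (assoc g (g ⁻¹) h)) (trans (cong (_· h) (inverseʳ g)) (identityˡ h)))
    (λ h → trans (sym (assoc (g ⁻¹) g h)) (trans (cong (_· h) (inverseˡ g)) (identityˡ h)))

  ρ-reg : Carrier → Perm
  ρ-reg g = mk↔ₛ′ (λ h → h · g ⁻¹) (λ h → h · g)
    (λ h → trans (assoc h g (g ⁻¹)) (trans (cong (h ·_) (inverseʳ g)) (identityʳ h)))
    (λ h → trans (assoc h (g ⁻¹) g) (trans (cong (h ·_) (inverseˡ g)) (identityʳ h)))

  conj : Perm → Perm → Perm
  conj σ η = σ ∘ₚ (η ∘ₚ (σ ⁻¹ₚ))

  -- membership in a subgroup presented by a finite list (Fin m → Perm) of
  -- its elements (without repetition)
  _∈ₚ_ : ∀ {m} → Perm → (Fin m → Perm) → Set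
  σ ∈ₚ N = ∃ λ i → σ ≗ₚ N i

  record IsSubgroup {m : ℕ} (N : Fin m → Perm) : Set where
    field
      distinct : ∀ i j → N i ≗ₚ N j → i ≡ j
      has-id   : idₚ ∈ₚ N
      ∘-closed : ∀ i j → (N i ∘ₚ N j) ∈ₚ N
      ⁻¹-closed : ∀ i → (N i ⁻¹ₚ) ∈ₚ N

  IsRegular : ∀ {m} → (Fin m → Perm) → Set
  IsRegular N = ∀ h h′ → ∃ λ i → (N i [ h ] ≡ h′) × (∀ j → N j [ h ] ≡ h′ → j ≡ i)

  IsGStable : ∀ {m} → (Fin m → Perm) → Set
  IsGStable N = ∀ g i → conj (λ-reg g) (N i) ∈ₚ N

-- A finite Galois extension L/K with group G: G acts faithfully on the
-- field L by ring automorphisms, and K is the fixed field L^G (Artin).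

record GaloisAction {c ℓ} (G : FiniteGroup) (L : Field c ℓ) : Set (c ⊔ ℓ) where
  open FiniteGroup G
  open Field L
  field
    act      : FiniteGroup.Carrier G → Field.Carrier L → Field.Carrier L
    act-cong : ∀ g {x y} → x ≈ y → act g x ≈ act g y
    act-+    : ∀ g x y → act g (x + y) ≈ (act g x + act g y)
    act-*    : ∀ g x y → act g (x * y) ≈ (act g x * act g y)
    act-1    : ∀ g → act g 1# ≈ 1#
    act-e    : ∀ x → act e x ≈ x
    act-·    : ∀ g h x → act (g · h) x ≈ act g (act h x)
    faithful : ∀ g → (∀ x → act g x ≈ x) → g ≡ e

module GroupAlgebra {c ℓ} (G : FiniteGroup) (L : Field c ℓ)
                    (Gal : GaloisAction G L) where
  open FiniteGroup G
  open PermDefs G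
  open Field L
  open GaloisAction Gal
  open RawMonoidDefs +-rawMonoid using (sum)

  -- an element Σ_{i} c i · N i of L[N]
  record GroupAlgElt {m : ℕ} (N : Fin m → Perm) : Set c where
    constructor ⟨_⟩
    field coeff : Fin m → Field.Carrier L
  open GroupAlgElt public

  -- z ∈ L[N]^G :  g ∗ z = z for all g, where
  -- g ∗ Σ c_η η = Σ g(c_η) λ(g) η λ(g)⁻¹
  IsFixed : ∀ {m} {N : Fin m → Perm} → GroupAlgElt N → Set ℓ
  IsFixed {N = N} z = ∀ g i j → conj (λ-reg g) (N i) ≗ₚ N j →
                        coeff z j ≈ act g (coeff z i)

  _⊙_ : ∀ {m} {N : Fin m → Perm} → GroupAlgElt N → Field.Carrier L → Field.Carrier L
  _⊙_ {N = N} z x = sum (λ i → coeff z i * act ((N i ⁻¹ₚ) [ e ]) x)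

  conjρ : ∀ {m} → FiniteGroup.Carrier G → (Fin m → Perm) → (Fin m → Perm)
  conjρ g N i = conj (ρ-reg g) (N i)

  -- φ(Σ c_η η) = Σ c_η ρ(g) η ρ(g)⁻¹
  φ : ∀ {m} {N : Fin m → Perm} (g : FiniteGroup.Carrier G) →
      GroupAlgElt N → GroupAlgElt (conjρ g N)
  φ g z = ⟨ coeff z ⟩

{-# OPTIONS --safe #-}
-- The proof is a change of summation index.  Writing φ(z) = Σ c_η ρ(g)ηρ(g)⁻¹, the
-- element (ρ(g)ηρ(g)⁻¹)⁻¹[e] of G is η⁻¹[g]·g⁻¹.  Conjugation by λ(g) permutes N, so we
-- may replace η by λ(g)ηλ(g)⁻¹, whose coefficient is g(c_η) because z is G-fixed and
-- whose inverse sends g to g·η⁻¹[e].  Each summand then becomes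
-- g(c_η)·(g·η⁻¹[e]·g⁻¹)(x) = g(c_η·η⁻¹[e](g⁻¹(x))), and g is additive.
module Submission where

open import Defs
open import Level using (Level)
open import Data.Nat using (ℕ; zero; suc)
open import Data.Fin using (Fin; suc)
open import Data.Fin.Permutation using (Permutation)
open import Data.Product using (proj₁; proj₂)
open import Function using (Inverse; _∘_)
open import Function.Bundles using (mk↔ₛ′)
open import Relation.Binary.PropositionalEquality as ≡ using (_≡_; cong)
open import Algebra.Bundles using (Group)
open import Algebra.Structures using (IsGroup)
import Algebra.Definitions.RawMonoid as RawMonoidDefs
import Algebra.Properties.Group as GroupProperties
import Algebra.Properties.CommutativeMonoid.Sum as CommutativeMonoidSum
import Relation.Binary.Reasoning.Setoid as SetoidReasoning

module _ {a ℓ} (H : Group a ℓ) where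
  open Group H
  open GroupProperties H using (identityˡ-unique)
  open RawMonoidDefs rawMonoid using (sum)

  module _ (f : Carrier → Carrier) (f-cong : ∀ {x y} → x ≈ y → f x ≈ f y)
           (f-∙ : ∀ x y → f (x ∙ y) ≈ f x ∙ f y) where

    ∙-homo⇒ε-homo : f ε ≈ ε
    ∙-homo⇒ε-homo = identityˡ-unique (f ε) (f ε) (trans (sym (f-∙ ε ε)) (f-cong (identityˡ ε)))

    ∙-homo⇒sum-homo : ∀ {n} (xs : Fin n → Carrier) → f (sum xs) ≈ sum (f ∘ xs)
    ∙-homo⇒sum-homo {zero}  xs = ∙-homo⇒ε-homo
    ∙-homo⇒sum-homo {suc n} xs = trans (f-∙ _ _) (∙-congˡ (∙-homo⇒sum-homo (xs ∘ suc)))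

module Permutations (G : FiniteGroup) where
  open FiniteGroup G
  open IsGroup isGroup using (identityˡ; inverseˡ)
  open PermDefs G

  group : Group _ _
  group = record { isGroup = isGroup }

  open GroupProperties group using (\\-leftDividesʳ; ⁻¹-involutive)

  ≗ₚ-⁻¹ₚ : ∀ {σ τ} → σ ≗ₚ τ → (σ ⁻¹ₚ) ≗ₚ (τ ⁻¹ₚ)
  ≗ₚ-⁻¹ₚ {σ} {τ} σ≗τ h = begin
    Inverse.from σ h                               ≡⟨ Inverse.strictlyInverseʳ τ _ ⟨
    Inverse.from τ (τ [ Inverse.from σ h ])        ≡⟨ cong (Inverse.from τ) (σ≗τ _) ⟨
    Inverse.from τ (σ [ Inverse.from σ h ])        ≡⟨ cong (Inverse.from τ) (Inverse.strictlyInverseˡ σ h) ⟩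
    Inverse.from τ h                               ∎
    where open ≡.≡-Reasoning

  conj-λ-cong : ∀ g {σ τ} → σ ≗ₚ τ → conj (λ-reg g) σ ≗ₚ conj (λ-reg g) τ
  conj-λ-cong g σ≗τ h = cong (g ·_) (σ≗τ (g ⁻¹ · h))

  conj-λ-⁻¹ : ∀ g η → conj (λ-reg (g ⁻¹)) (conj (λ-reg g) η) ≗ₚ η
  conj-λ-⁻¹ g η h = begin
    g ⁻¹ · (g · η [ g ⁻¹ · (g ⁻¹ ⁻¹ · h) ])  ≡⟨ \\-leftDividesʳ g _ ⟩
    η [ g ⁻¹ · (g ⁻¹ ⁻¹ · h) ]               ≡⟨ cong (λ k → η [ g ⁻¹ · (k · h) ]) (⁻¹-involutive g) ⟩
    η [ g ⁻¹ · (g · h) ]                     ≡⟨ cong (η [_]) (\\-leftDividesʳ g h) ⟩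
    η [ h ]                                  ∎
    where open ≡.≡-Reasoning

  conj-λ-⁻¹ₚ-at : ∀ g η → (conj (λ-reg g) η ⁻¹ₚ) [ g ] ≡ g · (η ⁻¹ₚ) [ e ]
  conj-λ-⁻¹ₚ-at g η = cong (λ h → g · (η ⁻¹ₚ) [ h ]) (inverseˡ g)

  conj-ρ-⁻¹ₚ-at-e : ∀ g η → (conj (ρ-reg g) η ⁻¹ₚ) [ e ] ≡ (η ⁻¹ₚ) [ g ] · g ⁻¹
  conj-ρ-⁻¹ₚ-at-e g η = cong (λ h → (η ⁻¹ₚ) [ h ] · g ⁻¹) (identityˡ g)

module StableSubgroup (G : FiniteGroup) {m : ℕ} (N : Fin m → PermDefs.Perm G)
                      (sub : PermDefs.IsSubgroup G N) (stable : PermDefs.IsGStable G N) where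
  open FiniteGroup G
  open PermDefs G
  open Permutations G
  open IsSubgroup sub using (distinct)
  open GroupProperties group using (⁻¹-involutive)

  λ-conjIndex : Carrier → Fin m → Fin m
  λ-conjIndex g i = proj₁ (stable g i)

  λ-conjIndex-spec : ∀ g i → conj (λ-reg g) (N i) ≗ₚ N (λ-conjIndex g i)
  λ-conjIndex-spec g i = proj₂ (stable g i)

  λ-conjIndex-⁻¹ : ∀ g i → λ-conjIndex (g ⁻¹) (λ-conjIndex g i) ≡ i
  λ-conjIndex-⁻¹ g i = distinct _ _ λ h → begin
    N (λ-conjIndex (g ⁻¹) (λ-conjIndex g i)) [ h ]  ≡⟨ λ-conjIndex-spec (g ⁻¹) _ h ⟨
    conj (λ-reg (g ⁻¹)) (N (λ-conjIndex g i)) [ h ] ≡⟨ conj-λ-cong (g ⁻¹) {N (λ-conjIndex g i)} {conj (λ-reg g) (N i)} (λ k → ≡.sym (λ-conjIndex-spec g i k)) h ⟩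
    conj (λ-reg (g ⁻¹)) (conj (λ-reg g) (N i)) [ h ] ≡⟨ conj-λ-⁻¹ g (N i) h ⟩
    N i [ h ]                                        ∎
    where open ≡.≡-Reasoning

  λ-conjPermutation : Carrier → Permutation m m
  λ-conjPermutation g = mk↔ₛ′ (λ-conjIndex g) (λ-conjIndex (g ⁻¹))
    (λ i → ≡.trans (cong (λ h → λ-conjIndex h (λ-conjIndex (g ⁻¹) i)) (≡.sym (⁻¹-involutive g))) (λ-conjIndex-⁻¹ (g ⁻¹) i))
    (λ-conjIndex-⁻¹ g)

  λ-conjIndex-⁻¹ₚ-at : ∀ g i → (N (λ-conjIndex g i) ⁻¹ₚ) [ g ] ≡ g · (N i ⁻¹ₚ) [ e ]
  λ-conjIndex-⁻¹ₚ-at g i =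
    ≡.trans (≡.sym (≗ₚ-⁻¹ₚ {conj (λ-reg g) (N i)} {N (λ-conjIndex g i)} (λ-conjIndex-spec g i) g)) (conj-λ-⁻¹ₚ-at g (N i))

module Galois {c ℓ} (G : FiniteGroup) (L : Field c ℓ) (Gal : GaloisAction G L) where
  open FiniteGroup G
  open Field L hiding (Carrier)
  open GaloisAction Gal
  open RawMonoidDefs +-rawMonoid using (sum)
  open SetoidReasoning setoid

  act-sum : ∀ g {n} (xs : Fin n → Field.Carrier L) → act g (sum xs) ≈ sum (act g ∘ xs)
  act-sum g = ∙-homo⇒sum-homo +-group (act g) (act-cong g) (act-+ g)

  act-conj : ∀ g a x → act (g · a · g ⁻¹) x ≈ act g (act a (act (g ⁻¹) x))
  act-conj g a x = begin
    act (g · a · g ⁻¹) x             ≈⟨ act-· (g · a) (g ⁻¹) x ⟩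
    act (g · a) (act (g ⁻¹) x)       ≈⟨ act-· g a _ ⟩
    act g (act a (act (g ⁻¹) x))     ∎

proposition3p1 : ∀ {c ℓ : Level} (G : FiniteGroup) (L : Field c ℓ) (Gal : GaloisAction G L)
                   {m : ℕ} (N : Fin m → PermDefs.Perm G)
                   → PermDefs.IsSubgroup G N → PermDefs.IsRegular G N → PermDefs.IsGStable G N
                   → (g : FiniteGroup.Carrier G)
                   → (z : GroupAlgebra.GroupAlgElt G L Gal N) → GroupAlgebra.IsFixed G L Gal z
                   → (x : Field.Carrier L)
                   → Field._≈_ L (GroupAlgebra._⊙_ G L Gal (GroupAlgebra.φ G L Gal g z) x)
                       (GaloisAction.act Gal g (GroupAlgebra._⊙_ G L Gal z (GaloisAction.act Gal (FiniteGroup._⁻¹ G g) x)))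
proposition3p1 G L Gal N sub _ stable g z fixed x = begin
  φ g z ⊙ x
    ≈⟨ Sum.sum-permute _ (λ-conjPermutation g) ⟩
  sum (λ i → coeff z (λ-conjIndex g i) * act ((conjρ g N (λ-conjIndex g i) ⁻¹ₚ) [ e ]) x)
    ≈⟨ Sum.sum-cong-≋ summand ⟩
  sum (λ i → act g (coeff z i * act ((N i ⁻¹ₚ) [ e ]) (act (g ⁻¹) x)))
    ≈⟨ act-sum g (λ i → coeff z i * act ((N i ⁻¹ₚ) [ e ]) (act (g ⁻¹) x)) ⟨
  act g (z ⊙ act (g ⁻¹) x) ∎
  where
    open FiniteGroup G
    open PermDefs G
    open Permutations G
    open StableSubgroup G N sub stable
    open Field L hiding (Carrier)
    open GaloisAction Gal
    open GroupAlgebra G L Gal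
    open Galois G L Gal
    open RawMonoidDefs +-rawMonoid using (sum)
    module Sum = CommutativeMonoidSum +-commutativeMonoid
    open SetoidReasoning setoid

    summand : ∀ i → coeff z (λ-conjIndex g i) * act ((conjρ g N (λ-conjIndex g i) ⁻¹ₚ) [ e ]) x
                    ≈ act g (coeff z i * act ((N i ⁻¹ₚ) [ e ]) (act (g ⁻¹) x))
    summand i = begin
      coeff z (λ-conjIndex g i) * act ((conjρ g N (λ-conjIndex g i) ⁻¹ₚ) [ e ]) x
        ≈⟨ *-congˡ (reflexive (cong (λ h → act h x) (conj-ρ-⁻¹ₚ-at-e g (N (λ-conjIndex g i))))) ⟩
      coeff z (λ-conjIndex g i) * act ((N (λ-conjIndex g i) ⁻¹ₚ) [ g ] · g ⁻¹) x
        ≈⟨ *-cong (fixed g i _ (λ-conjIndex-spec g i))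
                  (reflexive (cong (λ h → act (h · g ⁻¹) x) (λ-conjIndex-⁻¹ₚ-at g i))) ⟩
      act g (coeff z i) * act (g · (N i ⁻¹ₚ) [ e ] · g ⁻¹) x
        ≈⟨ *-congˡ (act-conj g _ x) ⟩
      act g (coeff z i) * act g (act ((N i ⁻¹ₚ) [ e ]) (act (g ⁻¹) x))
        ≈⟨ act-* g _ _ ⟨
      act g (coeff z i * act ((N i ⁻¹ₚ) [ e ]) (act (g ⁻¹) x)) ∎
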